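{- Let $p$ be a prime, $q=p^{r}$, $k\geq 3$ with $k\mid(q-1)$, $F=\mathrm{GF}(q)$, and $\Phi$ the unique multiplicative subgroup of $F^{*}$ of order $k$. Suppose $(F,\Phi)$ is circular. Let $\lambda,\psi\in\Phi\setminus\{1\}$ and $\chi=(\psi-1)^{ -1}(\lambda-1)$. If $\chi\in\Phi$, then either $\chi=1$ and $\psi=\lambda$, or $\chi=-\lambda$ and $\psi=\lambda^{ -1}$. In the second case, either $p=2$ or $|\Phi|$ is even.
   Context: The pair $(F,\Phi)$ is circular if $|\Phi a\cap(\Phi b+c)|\leq 2$ for all $a,b,c\in F^{*}$. -}

module Defs where

open import Level using (0ℓ)
open import Data.Bool using (Bool; true)
open import Data.Product using (Σ; ∃; _×_; _,_)
open import Relation.Binary.PropositionalEquality using (_≡_; _≢_)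
open import Data.Empty using (⊥)
open import Algebra.Structures using (IsCommutativeRing)

-- A field, with propositional equality on the carrier and a total
-- inversion function which is a genuine inverse on nonzero elements
-- (its value at 0 is irrelevant).
record Field : Set₁ where
  infixl 7 _*_
  infixl 6 _+_
  field
    Carrier : Set
    _+_ _*_ : Carrier → Carrier → Carrier
    -_ : Carrier → Carrier
    0# 1# : Carrier
    _⁻¹ : Carrier → Carrier
    isCommutativeRing : IsCommutativeRing _≡_ _+_ _*_ -_ 0# 1#
    0≢1 : 0# ≢ 1#
    inverseʳ : ∀ x → x ≢ 0# → x * (x ⁻¹) ≡ 1#

  _-_ : Carrier → Carrier → Carrier
  x - y = x + (- y)

module _ (F : Field) where
  open Field F

  Subset : Set
  Subset = Carrier → Bool

  _∈_ : Carrier → Subset → Set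
  x ∈ S = S x ≡ true

  record IsMulSubgroup (Φ : Subset) : Set where
    field
      nonzero : ∀ x → x ∈ Φ → x ≢ 0#
      one∈ : 1# ∈ Φ
      mul∈ : ∀ x y → x ∈ Φ → y ∈ Φ → (x * y) ∈ Φ
      inv∈ : ∀ x → x ∈ Φ → (x ⁻¹) ∈ Φ

  InCircleIntersection : Subset → Carrier → Carrier → Carrier → Carrier → Set
  InCircleIntersection Φ a b c x =
    (∃ λ φ → φ ∈ Φ × x ≡ φ * a) × (∃ λ φ′ → φ′ ∈ Φ × x ≡ φ′ * b + c)

  AtMostTwo : (Carrier → Set) → Set
  AtMostTwo S = ∀ x y z → S x → S y → S z → x ≢ y → x ≢ z → y ≢ z → ⊥

  Circular : Subset → Set
  Circular Φ = ∀ a b c → a ≢ 0# → b ≢ 0# → c ≢ 0# →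
    AtMostTwo (InCircleIntersection Φ a b c)

-- Put s = λ + χ. Unwinding the definition of χ gives s = ψχ + 1, so λ, χ, 1 and ψχ
-- all lie in Φ ∩ (s − Φ) = Φ·1 ∩ (Φ·(−1) + s). If χ ≠ 1 and s ≠ 0, circularity allows
-- at most two distinct points there, which forces λ = χ and ψχ = 1, hence 2λ = s = 2,
-- hence 2 ≠ 0 and λ = 1: impossible. So χ = 1 (and then ψ = λ) or s = 0, i.e. χ = −λ,
-- and then ψχ = −1 gives ψ = λ⁻¹. In the latter case −1 = χλ⁻¹ ∈ Φ: if char F = 2,
-- x ↦ x + 1 is a fixed-point-free involution of F, so 2 divides |F| = p^r and p = 2;
-- otherwise x ↦ −x is a fixed-point-free involution of Φ, so |Φ| = k is even.
module Submission where

open import Defs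
open import Level using (0ℓ)
open import Algebra.Bundles using (CommutativeRing)
open import Algebra.Definitions using (Involutive; AlmostLeftCancellative)
open import Axiom.UniquenessOfIdentityProofs using (module Decidable⇒UIP)
open import Data.Bool using (Bool)
import Data.Bool as Bool
open import Data.Empty using (⊥-elim)
open import Data.Fin using (Fin)
open import Data.Fin.Properties using (inj⇒≟)
open import Data.Nat using (ℕ; zero; suc; _^_; _∸_; _≥_)
open import Data.Nat.Divisibility using (_∣_; ∣1⇒≡1)
open import Data.Nat.Primality using (Prime; euclidsLemma; prime[2]; prime⇒irreducible; ¬prime[1])
open import Data.Product using (Σ; ∃; _×_; _,_; proj₁)
open import Data.Sum using (_⊎_; inj₁; inj₂; map₂)
open import Function.Base using (_∘′_)
open import Function.Bundles using (_↔_; Inverse)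
open import Function.Construct.Symmetry using (↔-sym)
open import Function.Properties.Inverse using (↔⇒↣)
open import Relation.Binary.Definitions using (DecidableEquality)
open import Relation.Binary.PropositionalEquality
open import Relation.Nullary using (yes; no)
open import Relation.Nullary.Decidable using (decidable-stable)

module InvolutionParity where
  open import Data.Fin using (_<?_)
  open import Data.Fin.Permutation using (permutation)
  import Data.Fin.Properties as Fin
  open import Data.Nat using (_+_; _*_)
  open import Data.Nat.Divisibility using (divides)
  open import Data.Nat.Properties using (+-0-commutativeMonoid; ≮⇒≥; *-comm; +-identityʳ)
  open import Algebra.Properties.CommutativeMonoid.Sum +-0-commutativeMonoid
    using (sum; ∑-distrib-+; sum-permute; sum-cong-≗)

  [_<_] : ∀ {n} → Fin n → Fin n → ℕ
  [ i < j ] with i <? j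
  ... | yes _ = 1
  ... | no  _ = 0

  [<]+[>]≡1 : ∀ {n} (i j : Fin n) → i ≢ j → [ i < j ] + [ j < i ] ≡ 1
  [<]+[>]≡1 i j i≢j with i <? j | j <? i
  ... | yes i<j | yes j<i = ⊥-elim (Fin.<-asym i<j j<i)
  ... | yes _   | no  _   = refl
  ... | no  _   | yes _   = refl
  ... | no  i≮j | no  j≮i = ⊥-elim (i≢j (Fin.≤-antisym (≮⇒≥ j≮i) (≮⇒≥ i≮j)))

  sum-const-1 : ∀ n → sum {n} (λ _ → 1) ≡ n
  sum-const-1 zero    = refl
  sum-const-1 (suc n) = cong suc (sum-const-1 n)

  -- Every orbit {i, g i} is counted once, by its smaller element.
  fixedPointFree-involution⇒even : ∀ {n} (g : Fin n → Fin n) →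
    Involutive _≡_ g → (∀ i → g i ≢ i) → 2 ∣ n
  fixedPointFree-involution⇒even {n} g g-invol g-free = divides (sum smaller) (begin
    n                                     ≡⟨ sum-const-1 n ⟨
    sum {n} (λ _ → 1)                     ≡⟨ sum-cong-≗ pair-counted-once ⟩
    sum (λ i → smaller i + smaller (g i)) ≡⟨ ∑-distrib-+ smaller (smaller ∘′ g) ⟩
    sum smaller + sum (smaller ∘′ g)      ≡⟨ cong (sum smaller +_) (sum-permute smaller g-perm) ⟨
    sum smaller + sum smaller             ≡⟨ cong (sum smaller +_) (+-identityʳ _) ⟨
    2 * sum smaller                       ≡⟨ *-comm 2 (sum smaller) ⟩
    sum smaller * 2                       ∎)
    where
    open ≡-Reasoning
    smaller : Fin n → ℕ
    smaller i = [ i < g i ]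
    g-perm = permutation g g g-invol g-invol
    pair-counted-once : ∀ i → 1 ≡ smaller i + smaller (g i)
    pair-counted-once i rewrite g-invol i = sym ([<]+[>]≡1 i (g i) (g-free i ∘′ sym))

  fixedPointFree-involution⇒even-card : ∀ {n} {A : Set} → Fin n ↔ A → (f : A → A) →
    Involutive _≡_ f → (∀ x → f x ≢ x) → 2 ∣ n
  fixedPointFree-involution⇒even-card fin↔A f f-invol f-free =
    fixedPointFree-involution⇒even (from ∘′ f ∘′ to) g-invol g-free
    where
    open Inverse fin↔A
    g-invol : ∀ i → from (f (to (from (f (to i))))) ≡ i
    g-invol i = begin
      from (f (to (from (f (to i))))) ≡⟨ cong (from ∘′ f) (strictlyInverseˡ (f (to i))) ⟩
      from (f (f (to i)))             ≡⟨ cong from (f-invol (to i)) ⟩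
      from (to i)                     ≡⟨ strictlyInverseʳ i ⟩
      i                               ∎
      where open ≡-Reasoning
    g-free : ∀ i → from (f (to i)) ≢ i
    g-free i g[i]≡i = f-free (to i) (trans (sym (strictlyInverseˡ (f (to i)))) (cong to g[i]≡i))

open InvolutionParity using (fixedPointFree-involution⇒even-card)

prime∣prime^⇒≡ : ∀ {p q} r → Prime p → Prime q → q ∣ p ^ r → q ≡ p
prime∣prime^⇒≡ zero _ q-prime q∣1 = ⊥-elim (¬prime[1] (subst Prime (∣1⇒≡1 q∣1) q-prime))
prime∣prime^⇒≡ {p} (suc r) p-prime q-prime q∣p^1+r
  with euclidsLemma p (p ^ r) q-prime q∣p^1+r
... | inj₂ q∣p^r = prime∣prime^⇒≡ r p-prime q-prime q∣p^r
... | inj₁ q∣p with prime⇒irreducible p-prime q∣p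
...   | inj₁ q≡1 = ⊥-elim (¬prime[1] (subst Prime q≡1 q-prime))
...   | inj₂ q≡p = q≡p

module FieldProperties (F : Field) where
  open Field F

  commutativeRing : CommutativeRing 0ℓ 0ℓ
  commutativeRing = record { isCommutativeRing = isCommutativeRing }

  open CommutativeRing commutativeRing public
    using (+-assoc; +-comm; +-identityˡ; +-identityʳ; *-assoc; *-comm; *-identityˡ; *-identityʳ;
           -‿inverseʳ; distribʳ; +-group; ring)
  open import Algebra.Properties.Group +-group public
    using (\\-leftDividesʳ; ∙-cancelˡ; ∙-cancelʳ; inverseˡ-unique; inverseʳ-unique;
           ⁻¹-injective; ⁻¹-involutive; x∙y⁻¹≈ε⇒x≈y)
  open import Algebra.Properties.Ring ring public
    using (-1*x≈-x; -‿distribˡ-*; -‿distribʳ-*; [y-z]x≈yx-zx)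
  open ≡-Reasoning

  2# : Carrier
  2# = 1# + 1#

  x⁻¹*[x*y]≡y : ∀ x y → x ≢ 0# → x ⁻¹ * (x * y) ≡ y
  x⁻¹*[x*y]≡y x y x≢0 = begin
    x ⁻¹ * (x * y) ≡⟨ *-assoc (x ⁻¹) x y ⟨
    x ⁻¹ * x * y   ≡⟨ cong (_* y) (trans (*-comm (x ⁻¹) x) (inverseʳ x x≢0)) ⟩
    1# * y         ≡⟨ *-identityˡ y ⟩
    y              ∎

  x*[x⁻¹*y]≡y : ∀ x y → x ≢ 0# → x * (x ⁻¹ * y) ≡ y
  x*[x⁻¹*y]≡y x y x≢0 = begin
    x * (x ⁻¹ * y) ≡⟨ *-assoc x (x ⁻¹) y ⟨
    x * x ⁻¹ * y   ≡⟨ cong (_* y) (inverseʳ x x≢0) ⟩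
    1# * y         ≡⟨ *-identityˡ y ⟩
    y              ∎

  *-cancelˡ-nonZero : AlmostLeftCancellative _≡_ 0# _*_
  *-cancelˡ-nonZero x y z x≢0 xy≡xz = begin
    y              ≡⟨ x⁻¹*[x*y]≡y x y x≢0 ⟨
    x ⁻¹ * (x * y) ≡⟨ cong (x ⁻¹ *_) xy≡xz ⟩
    x ⁻¹ * (x * z) ≡⟨ x⁻¹*[x*y]≡y x z x≢0 ⟩
    z              ∎

  x*y≡1⇒y≡x⁻¹ : ∀ {x y} → x ≢ 0# → x * y ≡ 1# → y ≡ x ⁻¹
  x*y≡1⇒y≡x⁻¹ {x} {y} x≢0 xy≡1 =
    *-cancelˡ-nonZero x y (x ⁻¹) x≢0 (trans xy≡1 (sym (inverseʳ x x≢0)))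

  x-y≡z-w⇒x+w≡z+y : ∀ x y z w → x - y ≡ z - w → x + w ≡ z + y
  x-y≡z-w⇒x+w≡z+y x y z w x-y≡z-w = begin
    x + w               ≡⟨ cong (x +_) (\\-leftDividesʳ y w) ⟨
    x + (- y + (y + w)) ≡⟨ +-assoc x (- y) (y + w) ⟨
    (x - y) + (y + w)   ≡⟨ cong₂ _+_ x-y≡z-w (+-comm y w) ⟩
    (z - w) + (w + y)   ≡⟨ +-assoc z (- w) (w + y) ⟩
    z + (- w + (w + y)) ≡⟨ cong (z +_) (\\-leftDividesʳ w y) ⟩
    z + y               ∎

  x≢1⇒x-1≢0 : ∀ {x} → x ≢ 1# → x - 1# ≢ 0#
  x≢1⇒x-1≢0 {x} x≢1 = x≢1 ∘′ x∙y⁻¹≈ε⇒x≈y x 1#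

  [x-1]*y≡z-1⇒x*y+1≡z+y : ∀ x y z → (x - 1#) * y ≡ z - 1# → x * y + 1# ≡ z + y
  [x-1]*y≡z-1⇒x*y+1≡z+y x y z [x-1]*y≡z-1 = x-y≡z-w⇒x+w≡z+y (x * y) y z 1# (begin
    (x * y) - y        ≡⟨ cong (λ t → (x * y) - t) (*-identityˡ y) ⟨
    (x * y) - (1# * y) ≡⟨ [y-z]x≈yx-zx y x 1# ⟨
    (x - 1#) * y       ≡⟨ [x-1]*y≡z-1 ⟩
    z - 1#             ∎)

  x+x≡2*x : ∀ x → x + x ≡ 2# * x
  x+x≡2*x x = sym (trans (distribʳ x 1# 1#) (cong₂ _+_ (*-identityˡ x) (*-identityˡ x)))

  x+x≡y+y⇒x≡y : 2# ≢ 0# → ∀ {x y} → x + x ≡ y + y → x ≡ y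
  x+x≡y+y⇒x≡y 2≢0 {x} {y} x+x≡y+y =
    *-cancelˡ-nonZero 2# x y 2≢0 (trans (sym (x+x≡2*x x)) (trans x+x≡y+y (x+x≡2*x y)))

  -x≡x⇒x≡0 : 2# ≢ 0# → ∀ {x} → - x ≡ x → x ≡ 0#
  -x≡x⇒x≡0 2≢0 {x} -x≡x = x+x≡y+y⇒x≡y 2≢0 (begin
    x + x   ≡⟨ cong (x +_) -x≡x ⟨
    x - x   ≡⟨ -‿inverseʳ x ⟩
    0#      ≡⟨ +-identityʳ 0# ⟨
    0# + 0# ∎)

  x+1≢x : ∀ x → x + 1# ≢ x
  x+1≢x x x+1≡x = 0≢1 (sym (∙-cancelˡ x 1# 0# (trans x+1≡x (sym (+-identityʳ x)))))

  -1≢0 : - 1# ≢ 0#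
  -1≢0 -1≡0 = 0≢1 (x∙y⁻¹≈ε⇒x≈y 0# 1# (trans (+-identityˡ (- 1#)) -1≡0))

  2≡0⇒even-order : ∀ {n} → 2# ≡ 0# → Fin n ↔ Carrier → 2 ∣ n
  2≡0⇒even-order 2≡0 fin↔F = fixedPointFree-involution⇒even-card fin↔F (_+ 1#) +1-involutive x+1≢x
    where
    +1-involutive : ∀ x → x + 1# + 1# ≡ x
    +1-involutive x = trans (+-assoc x 1# 1#) (trans (cong (x +_) 2≡0) (+-identityʳ x))

module MulSubgroup (F : Field) (_≟_ : DecidableEquality (Field.Carrier F))
    {Φ : Subset F} (Φ-subgroup : IsMulSubgroup F Φ) where
  open Field F
  open FieldProperties F
  open IsMulSubgroup Φ-subgroup

  infix 4 _∈Φ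
  _∈Φ : Carrier → Set
  x ∈Φ = _∈_ F x Φ

  Σ∈Φ-≡ : ∀ {x y} {x∈Φ : x ∈Φ} {y∈Φ : y ∈Φ} → x ≡ y → (x , x∈Φ) ≡ (y , y∈Φ)
  Σ∈Φ-≡ refl = cong (_ ,_) (Decidable⇒UIP.≡-irrelevant Bool._≟_ _ _)

  -1∈Φ⇒even-order : ∀ {k} → 2# ≢ 0# → - 1# ∈Φ → Fin k ↔ Σ Carrier _∈Φ → 2 ∣ k
  -1∈Φ⇒even-order 2≢0 -1∈Φ fin↔Φ =
    fixedPointFree-involution⇒even-card fin↔Φ negate negate-involutive negate-free
    where
    negate : Σ Carrier _∈Φ → Σ Carrier _∈Φ
    negate (x , x∈Φ) = - x , subst _∈Φ (-1*x≈-x x) (mul∈ (- 1#) x -1∈Φ x∈Φ)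
    negate-involutive : ∀ x → negate (negate x) ≡ x
    negate-involutive (x , x∈Φ) = Σ∈Φ-≡ (⁻¹-involutive x)
    negate-free : ∀ x → negate x ≢ x
    negate-free (x , x∈Φ) -x≡x = nonzero x x∈Φ (-x≡x⇒x≡0 2≢0 (cong proj₁ -x≡x))

  -x∈Φ⇒-1∈Φ : ∀ {x} → x ∈Φ → - x ∈Φ → - 1# ∈Φ
  -x∈Φ⇒-1∈Φ {x} x∈Φ -x∈Φ = subst _∈Φ -x*x⁻¹≡-1 (mul∈ (- x) (x ⁻¹) -x∈Φ (inv∈ x x∈Φ))
    where
    -x*x⁻¹≡-1 : - x * x ⁻¹ ≡ - 1#
    -x*x⁻¹≡-1 = trans (sym (-‿distribˡ-* x (x ⁻¹))) (cong -_ (inverseʳ x (nonzero x x∈Φ)))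

  Summand : Carrier → Carrier → Set
  Summand s x = ∃ λ v → x ∈Φ × v ∈Φ × x + v ≡ s

  summand⇒∈circleIntersection : ∀ {s x} → Summand s x → InCircleIntersection F Φ 1# (- 1#) s x
  summand⇒∈circleIntersection {s} {x} (v , x∈Φ , v∈Φ , x+v≡s) =
    (x , x∈Φ , sym (*-identityʳ x)) , (v , v∈Φ , sym (begin
      v * - 1# + s  ≡⟨ cong (_+ s) (trans (sym (-‿distribʳ-* v 1#)) (cong -_ (*-identityʳ v))) ⟩
      - v + s       ≡⟨ cong (- v +_) (trans (sym x+v≡s) (+-comm x v)) ⟩
      - v + (v + x) ≡⟨ \\-leftDividesʳ v x ⟩
      x             ∎))
    where open ≡-Reasoning

  module _ (Φ-circular : Circular F Φ) where

    atMostTwoSummands : ∀ {s} → s ≢ 0# → AtMostTwo F (Summand s)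
    atMostTwoSummands s≢0 x y z x-summand y-summand z-summand =
      Φ-circular 1# (- 1#) _ (0≢1 ∘′ sym) -1≢0 s≢0 x y z
        (summand⇒∈circleIntersection x-summand)
        (summand⇒∈circleIntersection y-summand)
        (summand⇒∈circleIntersection z-summand)

    module _ {lam ψ χ} (lam∈Φ : lam ∈Φ) (ψ∈Φ : ψ ∈Φ) (χ∈Φ : χ ∈Φ) (lam≢1 : lam ≢ 1#) (ψ≢1 : ψ ≢ 1#)
             (ψχ+1≡lam+χ : ψ * χ + 1# ≡ lam + χ) where
      open ≡-Reasoning

      ψχ∈Φ : ψ * χ ∈Φ
      ψχ∈Φ = mul∈ ψ χ ψ∈Φ χ∈Φ

      lam-summand : Summand (lam + χ) lam
      lam-summand = χ , lam∈Φ , χ∈Φ , refl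

      χ-summand : Summand (lam + χ) χ
      χ-summand = lam , χ∈Φ , lam∈Φ , +-comm χ lam

      1-summand : Summand (lam + χ) 1#
      1-summand = ψ * χ , one∈ , ψχ∈Φ , trans (+-comm 1# (ψ * χ)) ψχ+1≡lam+χ

      ψχ-summand : Summand (lam + χ) (ψ * χ)
      ψχ-summand = 1# , ψχ∈Φ , one∈ , ψχ+1≡lam+χ

      χ≢1⇒lam+χ≢0⇒lam≡1 : χ ≢ 1# → lam + χ ≢ 0# → lam ≡ 1#
      χ≢1⇒lam+χ≢0⇒lam≡1 χ≢1 s≢0 = x+x≡y+y⇒x≡y 2≢0 (sym 2≡lam+lam)
        where
        atMostTwo = atMostTwoSummands s≢0

        lam≡χ : lam ≡ χ
        lam≡χ = decidable-stable (lam ≟ χ) λ lam≢χ →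
          atMostTwo lam 1# χ lam-summand 1-summand χ-summand lam≢1 lam≢χ (χ≢1 ∘′ sym)

        lam≢ψχ : lam ≢ ψ * χ
        lam≢ψχ lam≡ψχ = ψ≢1 (*-cancelˡ-nonZero χ ψ 1# (nonzero χ χ∈Φ) (begin
          χ * ψ  ≡⟨ *-comm χ ψ ⟩
          ψ * χ  ≡⟨ lam≡ψχ ⟨
          lam    ≡⟨ lam≡χ ⟩
          χ      ≡⟨ *-identityʳ χ ⟨
          χ * 1# ∎))

        ψχ≡1 : ψ * χ ≡ 1#
        ψχ≡1 = decidable-stable ((ψ * χ) ≟ 1#) λ ψχ≢1 →
          atMostTwo lam 1# (ψ * χ) lam-summand 1-summand ψχ-summand lam≢1 lam≢ψχ (ψχ≢1 ∘′ sym)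

        2≡lam+lam : 2# ≡ lam + lam
        2≡lam+lam = begin
          1# + 1#    ≡⟨ cong (_+ 1#) ψχ≡1 ⟨
          ψ * χ + 1# ≡⟨ ψχ+1≡lam+χ ⟩
          lam + χ    ≡⟨ cong (lam +_) lam≡χ ⟨
          lam + lam  ∎

        2≢0 : 2# ≢ 0#
        2≢0 2≡0 = s≢0 (begin
          lam + χ   ≡⟨ cong (lam +_) lam≡χ ⟨
          lam + lam ≡⟨ 2≡lam+lam ⟨
          2#        ≡⟨ 2≡0 ⟩
          0#        ∎)

      χ≢1⇒lam+χ≡0 : χ ≢ 1# → lam + χ ≡ 0#
      χ≢1⇒lam+χ≡0 χ≢1 = decidable-stable ((lam + χ) ≟ 0#) (lam≢1 ∘′ χ≢1⇒lam+χ≢0⇒lam≡1 χ≢1)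

      circular-dichotomy : (χ ≡ 1# × ψ ≡ lam) ⊎ (χ ≡ - lam × ψ ≡ lam ⁻¹)
      circular-dichotomy with χ ≟ 1#
      ... | yes χ≡1 = inj₁ (χ≡1 , ∙-cancelʳ 1# ψ lam (begin
        ψ + 1#      ≡⟨ cong (_+ 1#) (*-identityʳ ψ) ⟨
        ψ * 1# + 1# ≡⟨ cong (λ t → ψ * t + 1#) χ≡1 ⟨
        ψ * χ + 1#  ≡⟨ ψχ+1≡lam+χ ⟩
        lam + χ     ≡⟨ cong (lam +_) χ≡1 ⟩
        lam + 1#    ∎))
      ... | no χ≢1 = inj₂ (χ≡-lam , x*y≡1⇒y≡x⁻¹ (nonzero lam lam∈Φ) lamψ≡1)
        where
        lam+χ≡0 = χ≢1⇒lam+χ≡0 χ≢1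
        χ≡-lam : χ ≡ - lam
        χ≡-lam = inverseʳ-unique lam χ lam+χ≡0
        lamψ≡1 : lam * ψ ≡ 1#
        lamψ≡1 = ⁻¹-injective (begin
          - (lam * ψ) ≡⟨ -‿distribˡ-* lam ψ ⟩
          - lam * ψ   ≡⟨ cong (_* ψ) χ≡-lam ⟨
          χ * ψ       ≡⟨ *-comm χ ψ ⟩
          ψ * χ       ≡⟨ inverseˡ-unique (ψ * χ) 1# (trans ψχ+1≡lam+χ lam+χ≡0) ⟩
          - 1#        ∎)

lemma8 : (p r k : ℕ) → Prime p → k ≥ 3 → k ∣ (p ^ r ∸ 1) →
    (F : Field) → (Fin (p ^ r) ↔ Field.Carrier F) →
    (Φ : Field.Carrier F → Bool) → IsMulSubgroup F Φ →
    (Fin k ↔ Σ (Field.Carrier F) (λ x → _∈_ F x Φ)) →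
    Circular F Φ →
    (lam ψ : Field.Carrier F) → _∈_ F lam Φ → _∈_ F ψ Φ →
    lam ≢ Field.1# F → ψ ≢ Field.1# F →
    let open Field F
        χ = ((ψ - 1#) ⁻¹) * (lam - 1#)
    in _∈_ F χ Φ →
       (χ ≡ 1# × ψ ≡ lam)
       ⊎ (χ ≡ - lam × ψ ≡ lam ⁻¹ × (p ≡ 2 ⊎ 2 ∣ k))
lemma8 p r k p-prime _ _ F fin↔F Φ Φ-subgroup fin↔Φ Φ-circular lam ψ lam∈Φ ψ∈Φ lam≢1 ψ≢1 χ∈Φ =
  map₂ (λ (χ≡-lam , ψ≡lam⁻¹) → χ≡-lam , ψ≡lam⁻¹ , p≡2⊎even-order χ≡-lam)
       (circular-dichotomy Φ-circular lam∈Φ ψ∈Φ χ∈Φ lam≢1 ψ≢1 ψχ+1≡lam+χ)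
  where
  open Field F
  open FieldProperties F
  _≟_ = inj⇒≟ (↔⇒↣ (↔-sym fin↔F))
  open MulSubgroup F _≟_ Φ-subgroup

  χ : Carrier
  χ = (ψ - 1#) ⁻¹ * (lam - 1#)

  ψχ+1≡lam+χ : ψ * χ + 1# ≡ lam + χ
  ψχ+1≡lam+χ = [x-1]*y≡z-1⇒x*y+1≡z+y ψ χ lam (x*[x⁻¹*y]≡y (ψ - 1#) (lam - 1#) (x≢1⇒x-1≢0 ψ≢1))

  p≡2⊎even-order : χ ≡ - lam → p ≡ 2 ⊎ 2 ∣ k
  p≡2⊎even-order χ≡-lam with 2# ≟ 0#
  ... | yes 2≡0 = inj₁ (sym (prime∣prime^⇒≡ r p-prime prime[2] (2≡0⇒even-order 2≡0 fin↔F)))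
  ... | no  2≢0 = inj₂ (-1∈Φ⇒even-order 2≢0 (-x∈Φ⇒-1∈Φ lam∈Φ (subst _∈Φ χ≡-lam χ∈Φ)) fin↔Φ)
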